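{- Let $\mathcal{R}$ be a commutative ring with $1$, and let $P\subseteq\mathcal{R}$ be a subset such that $0\notin P$ and $P$ is closed under addition and multiplication. Let $n\ge k\ge 2$ be integers. For $m\ge 2$ let $\mathcal{A}_m$ denote the set of symmetric $m\times m$ matrices with entries in $\{0,1\}$ and all diagonal entries zero (adjacency matrices of graphs on $m$ labeled vertices). Let $f:\mathcal{A}_k\to\mathcal{R}$ satisfy: $f(M)=0$ if $M$ is the adjacency matrix of the complete graph or of the empty graph, and $f(M)\in P$ otherwise. For $A\in\mathcal{A}_n$ and $S\in\binom{[n]}{k}$, let $A_S$ be the $k\times k$ principal submatrix of $A$ with row and column indices in $S$ (ordered as in $[n]$). Then \[ \sum_{A\in\mathcal{A}_n}\prod_{S\in\binom{[n]}{k}} f(A_S) = 0 \] if and only if $n\ge R(k)$.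
   Context: $[n]=\{1,\dots,n\}$; $\binom{[n]}{k}$ is the set of $k$-element subsets of $[n]$. The $k$-th diagonal Ramsey number $R(k)$ is the least positive integer $n$ such that every graph on $n$ vertices contains a clique of size $k$ or an independent set of size $k$. -}

module Defs where

open import Level using (Level)
open import Data.Bool using (Bool; true; false)
open import Data.Bool.Properties using (_≟_)
open import Data.Nat using (ℕ; zero; suc; _≤_; _<_)
open import Data.Fin using (Fin; zero; suc)
open import Data.Fin.Properties using (all?)
open import Data.Vec as Vec using (Vec; []; _∷_; lookup)
open import Data.List as List using (List; []; _∷_; _++_; map; concatMap; foldr)
open import Data.Product using (Σ; ∃; _×_; _,_; proj₁)
open import Data.Sum using (_⊎_)
open import Relation.Nullary using (Dec; yes; no; ¬_)
open import Relation.Nullary.Decidable using (_×-dec_)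
open import Relation.Binary.PropositionalEquality using (_≡_; _≢_)
open import Function.Definitions using (Injective)
open import Algebra.Bundles using (CommutativeRing)

-- m×m matrices with entries in {0,1} (false = 0, true = 1)
Mat : ℕ → Set
Mat m = Fin m → Fin m → Bool

IsAdj : ∀ {m} → Mat m → Set
IsAdj {m} M = (∀ i j → M i j ≡ M j i) × (∀ i → M i i ≡ false)

Adj : ℕ → Set
Adj m = Σ (Mat m) IsAdj

IsComplete : ∀ {m} → Adj m → Set
IsComplete {m} A = ∀ (i j : Fin m) → i ≢ j → proj₁ A i j ≡ true

IsEmptyGraph : ∀ {m} → Adj m → Set
IsEmptyGraph {m} A = ∀ (i j : Fin m) → proj₁ A i j ≡ false

allVecs : ∀ {A : Set} → List A → (m : ℕ) → List (Vec A m)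
allVecs xs zero = [] ∷ []
allVecs xs (suc m) = concatMap (λ x → map (x ∷_) (allVecs xs m)) xs

allMats : (m : ℕ) → List (Mat m)
allMats m = map (λ rows i j → lookup (lookup rows i) j)
                (allVecs (allVecs (true ∷ false ∷ []) m) m)

isAdj? : ∀ {m} (M : Mat m) → Dec (IsAdj M)
isAdj? M = (all? λ i → all? λ j → M i j ≟ M j i) ×-dec (all? λ i → M i i ≟ false)

collectAdj : ∀ {m} → List (Mat m) → List (Adj m)
collectAdj [] = []
collectAdj (M ∷ Ms) with isAdj? M
... | yes p = (M , p) ∷ collectAdj Ms
... | no _ = collectAdj Ms

-- enumeration of 𝒜_m (each element exactly once)
allAdj : (m : ℕ) → List (Adj m)
allAdj m = collectAdj (allMats m)

-- k-element subsets of [n], each listed once as its strictly increasing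
-- enumeration (a vector of k indices in Fin n)
subsets : (k n : ℕ) → List (Vec (Fin n) k)
subsets zero n = [] ∷ []
subsets (suc k) zero = []
subsets (suc k) (suc n) =
  map (λ v → zero ∷ Vec.map suc v) (subsets k n) ++ map (Vec.map suc) (subsets (suc k) n)

sub : ∀ {n k} → Adj n → Vec (Fin n) k → Adj k
sub (M , s , d) v =
  (λ i j → M (lookup v i) (lookup v j)) , (λ i j → s (lookup v i) (lookup v j)) , (λ i → d (lookup v i))

module _ {c ℓ : Level} (R : CommutativeRing c ℓ) where
  open CommutativeRing R

  sumR : List Carrier → Carrier
  sumR = foldr _+_ 0#

  prodR : List Carrier → Carrier
  prodR = foldr _*_ 1#

HasHomogeneous : ∀ {m} → Adj m → ℕ → Bool → Set
HasHomogeneous {m} A k b =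
  Σ (Fin k → Fin m) λ g → Injective _≡_ _≡_ g × (∀ i j → i ≢ j → proj₁ A (g i) (g j) ≡ b)

RamseyProp : ℕ → ℕ → Set
RamseyProp k r = ∀ (A : Adj r) → HasHomogeneous A k true ⊎ HasHomogeneous A k false

IsRamseyNumber : ℕ → ℕ → Set
IsRamseyNumber k r = 1 ≤ r × RamseyProp k r × (∀ m → 1 ≤ m → m < r → ¬ RamseyProp k m)

{-# OPTIONS --safe #-}
module Submission where

-- For a graph A on [n], the product of the f(A_S) over the k-sets S vanishes if A has a
-- homogeneous k-set, and otherwise lies in P, being a nonempty (k ≤ n) product of elements
-- of P.  As P ∪ {0} is closed under addition and 0 ∉ P, the sum over all graphs vanishes
-- exactly when every term does, i.e. when every graph on n vertices has a homogeneous
-- k-set; by minimality of R(k) and monotonicity in the number of vertices this means n ≥ R(k).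

open import Defs
open import Level using (Level)
open import Data.Nat using (ℕ; _≤_)
open import Data.List using (map)
open import Relation.Nullary using (¬_)
open import Function.Bundles using (_⇔_)
open import Algebra.Bundles using (CommutativeRing)

open import Level using (_⊔_)
open import Data.Nat using (zero; suc; z≤n; s≤s)
open import Data.Nat.Properties using (≮⇒≥; ≤-trans)
open import Data.Bool using (Bool; true; false)
import Data.Bool.Properties as Bool
open import Data.Fin using (Fin; zero; suc; punchIn; punchOut)
open import Data.Fin.Properties as Fin
  using (all?; any?; 0≢1+n; suc-injective; punchIn-injective; punchInᵢ≢i; punchOut-injective; punchIn-punchOut)
open import Data.Vec as Vec using (Vec; []; _∷_; lookup; tabulate)
open import Data.Vec.Properties using (lookup-map; lookup∘tabulate)
open import Data.List as List using (List; []; _∷_)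
open import Data.List.Relation.Unary.All as All using (All; []; _∷_)
import Data.List.Relation.Unary.All.Properties as Allₚ
open import Data.List.Relation.Unary.Any as Any using (Any; here; there)
import Data.List.Relation.Unary.Any.Properties as Anyₚ
open import Data.List.Membership.Propositional using (_∈_; find; lose)
open import Data.List.Membership.Propositional.Properties using (∈-map⁺; ∈-++⁺ˡ; ∈-++⁺ʳ; ∈-concat⁺′)
open import Data.Product using (∃; _×_; _,_; proj₁; map₂)
open import Data.Sum as Sum using (_⊎_; inj₁; inj₂)
open import Relation.Nullary using (Dec; yes; no; ¬?; contradiction)
open import Relation.Nullary.Decidable using (_→-dec_; _⊎-dec_)
open import Relation.Binary.PropositionalEquality as ≡ using (_≡_; _≢_; refl)
open import Function using (_∘_; id)
open import Function.Bundles using (Equivalence; mk⇔)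
open import Function.Definitions using (Injective)
open import Function.Construct.Composition using (_⇔-∘_)
open import Data.Sum.Function.Propositional using (_⊎-⇔_)

private
  variable
    b : Bool
    k l m n : ℕ

Distinct : Vec (Fin n) k → Set
Distinct S = Injective _≡_ _≡_ (lookup S)

map-suc-distinct : {v : Vec (Fin n) k} → Distinct v → Distinct (Vec.map suc v)
map-suc-distinct {v = v} v-distinct {i} {j} e =
  v-distinct (suc-injective (≡.trans (≡.sym (lookup-map i suc v)) (≡.trans e (lookup-map j suc v))))

zero∷map-suc-distinct : {v : Vec (Fin n) k} → Distinct v → Distinct (zero ∷ Vec.map suc v)
zero∷map-suc-distinct _ {zero} {zero} _ = refl
zero∷map-suc-distinct {v = v} _ {zero} {suc j} e = contradiction (≡.trans e (lookup-map j suc v)) 0≢1+n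
zero∷map-suc-distinct {v = v} _ {suc i} {zero} e = contradiction (≡.trans (≡.sym e) (lookup-map i suc v)) 0≢1+n
zero∷map-suc-distinct {v = v} v-distinct {suc i} {suc j} e = ≡.cong suc (map-suc-distinct {v = v} v-distinct e)

subsets-distinct : ∀ k n → All Distinct (subsets k n)
subsets-distinct zero n = (λ { {()} }) ∷ []
subsets-distinct (suc k) zero = []
subsets-distinct (suc k) (suc n) =
  Allₚ.++⁺ (Allₚ.map⁺ (All.map (λ {v} → zero∷map-suc-distinct {v = v}) (subsets-distinct k n)))
           (Allₚ.map⁺ (All.map (λ {v} → map-suc-distinct {v = v}) (subsets-distinct (suc k) n)))

∈-subsets⇒distinct : {S : Vec (Fin n) k} → S ∈ subsets k n → Distinct S
∈-subsets⇒distinct = All.lookup (subsets-distinct _ _)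

subsets-inhabited : k ≤ n → ∃ λ S → S ∈ subsets k n
subsets-inhabited z≤n = [] , here refl
subsets-inhabited (s≤s k≤n) =
  let S , S∈ = subsets-inhabited k≤n in zero ∷ Vec.map suc S , ∈-++⁺ˡ (∈-map⁺ _ S∈)

record _⊆Img_ (S : Vec (Fin n) k) (g : Fin m → Fin n) : Set where
  constructor via
  field
    preimage : Fin k → Fin m
    lookup≡ : ∀ i → lookup S i ≡ g (preimage i)

∷-⊆Img : ∀ {x} {S : Vec (Fin n) k} {g : Fin m → Fin n} a → x ≡ g a → S ⊆Img g → (x ∷ S) ⊆Img g
∷-⊆Img a x≡ga (via σ S≗) = via (λ { zero → a ; (suc i) → σ i }) λ { zero → x≡ga ; (suc i) → S≗ i }

⊆Img-∘ : {S : Vec (Fin n) k} {g : Fin m → Fin n} (h : Fin l → Fin m) → S ⊆Img (g ∘ h) → S ⊆Img g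
⊆Img-∘ h (via σ S≗) = via (h ∘ σ) S≗

module _ {g : Fin m → Fin (suc n)} (0∉g : ∀ i → zero ≢ g i) where

  lowered : Fin m → Fin n
  lowered i = punchOut (0∉g i)

  lowered-injective : Injective _≡_ _≡_ g → Injective _≡_ _≡_ lowered
  lowered-injective g-injective e = g-injective (punchOut-injective (0∉g _) (0∉g _) e)

  map-suc-⊆Img : {S : Vec (Fin n) k} → S ⊆Img lowered → Vec.map suc S ⊆Img g
  map-suc-⊆Img {S = S} (via σ S≗) =
    via σ λ i → ≡.trans (lookup-map i suc S) (≡.trans (≡.cong suc (S≗ i)) (punchIn-punchOut (0∉g (σ i))))

subsets-cover : (g : Fin k → Fin n) → Injective _≡_ _≡_ g → ∃ λ S → S ∈ subsets k n × S ⊆Img g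
subsets-cover {zero} g _ = [] , here refl , via id λ ()
subsets-cover {suc k} {zero} g _ with g zero
... | ()
subsets-cover {suc k} {suc n} g g-injective with any? (λ a → zero Fin.≟ g a)
... | yes (a , 0≡ga) =
  let S , S∈ , S⊆ = subsets-cover (lowered 0∉g∘punchIn) (lowered-injective 0∉g∘punchIn g∘punchIn-injective)
  in zero ∷ Vec.map suc S , ∈-++⁺ˡ (∈-map⁺ _ S∈) , ∷-⊆Img a 0≡ga (⊆Img-∘ (punchIn a) (map-suc-⊆Img 0∉g∘punchIn S⊆))
  where
  0∉g∘punchIn : ∀ i → zero ≢ g (punchIn a i)
  0∉g∘punchIn i 0≡g = punchInᵢ≢i a i (g-injective (≡.trans (≡.sym 0≡g) 0≡ga))

  g∘punchIn-injective : Injective _≡_ _≡_ (g ∘ punchIn a)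
  g∘punchIn-injective = punchIn-injective a _ _ ∘ g-injective
... | no 0∉img =
  let S , S∈ , S⊆ = subsets-cover (lowered 0∉g) (lowered-injective 0∉g g-injective)
  in Vec.map suc S , ∈-++⁺ʳ _ (∈-map⁺ _ S∈) , map-suc-⊆Img 0∉g {S = S} S⊆
  where
  0∉g : ∀ i → zero ≢ g i
  0∉g i 0≡gi = 0∉img (i , 0≡gi)

Monochromatic : Adj k → Bool → Set
Monochromatic {k} B b = ∀ (i j : Fin k) → i ≢ j → proj₁ B i j ≡ b

Homogeneous : Adj k → Set
Homogeneous B = Monochromatic B true ⊎ Monochromatic B false

monochromatic? : (B : Adj k) (b : Bool) → Dec (Monochromatic B b)
monochromatic? B b = all? λ i → all? λ j → ¬? (i Fin.≟ j) →-dec (proj₁ B i j Bool.≟ b)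

homogeneous? : (B : Adj k) → Dec (Homogeneous B)
homogeneous? B = monochromatic? B true ⊎-dec monochromatic? B false

emptyGraph⇔monochromatic-false : (B : Adj k) → IsEmptyGraph B ⇔ Monochromatic B false
emptyGraph⇔monochromatic-false B@(_ , _ , B-irreflexive) = mk⇔ (λ e i j _ → e i j) from
  where
  from : Monochromatic B false → IsEmptyGraph B
  from mono i j with i Fin.≟ j
  ... | yes refl = B-irreflexive i
  ... | no i≢j = mono i j i≢j

HasHomogeneousSet : Adj n → ℕ → Set
HasHomogeneousSet A k = HasHomogeneous A k true ⊎ HasHomogeneous A k false

_≋_ : Adj n → Adj n → Set
A ≋ A′ = ∀ i j → proj₁ A i j ≡ proj₁ A′ i j

hasHomogeneous-cong : {A A′ : Adj n} → A ≋ A′ → HasHomogeneous A k b → HasHomogeneous A′ k b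
hasHomogeneous-cong A≋A′ (g , g-injective , g-mono) =
  g , g-injective , λ i j i≢j → ≡.trans (≡.sym (A≋A′ (g i) (g j))) (g-mono i j i≢j)

monochromatic⇒hasHomogeneous : (B : Adj k) → Monochromatic B b → HasHomogeneous B k b
monochromatic⇒hasHomogeneous B mono = id , id , mono

sub-hasHomogeneous : (A : Adj n) (S : Vec (Fin n) m) → Distinct S →
  HasHomogeneous (sub A S) k b → HasHomogeneous A k b
sub-hasHomogeneous A S S-distinct (g , g-injective , g-mono) = _ , g-injective ∘ S-distinct , g-mono

hasHomogeneous⇔monochromatic-sub : (A : Adj n) →
  HasHomogeneous A k b ⇔ Any (λ S → Monochromatic (sub A S) b) (subsets k n)
hasHomogeneous⇔monochromatic-sub {n} {k} {b} A = mk⇔ to from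
  where
  to : HasHomogeneous A k b → Any (λ S → Monochromatic (sub A S) b) (subsets k n)
  to (g , g-injective , g-mono) with subsets-cover g g-injective
  ... | S , S∈ , via σ S≗ = lose S∈ mono
    where
    mono : Monochromatic (sub A S) b
    mono i j i≢j rewrite S≗ i | S≗ j =
      g-mono (σ i) (σ j) λ σi≡σj → i≢j (∈-subsets⇒distinct S∈ (≡.trans (S≗ i) (≡.trans (≡.cong g σi≡σj) (≡.sym (S≗ j)))))

  from : Any (λ S → Monochromatic (sub A S) b) (subsets k n) → HasHomogeneous A k b
  from any with find any
  ... | S , S∈ , mono = sub-hasHomogeneous A S (∈-subsets⇒distinct S∈) (monochromatic⇒hasHomogeneous (sub A S) mono)

hasHomogeneousSet⇔homogeneous-sub : (A : Adj n) →
  HasHomogeneousSet A k ⇔ Any (λ S → Homogeneous (sub A S)) (subsets k n)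
hasHomogeneousSet⇔homogeneous-sub A =
  mk⇔ Anyₚ.Any-⊎⁺ Anyₚ.Any-⊎⁻ ⇔-∘ (hasHomogeneous⇔monochromatic-sub A ⊎-⇔ hasHomogeneous⇔monochromatic-sub A)

allVecs-complete : ∀ {A : Set} {xs : List A} (v : Vec A m) → (∀ i → lookup v i ∈ xs) → v ∈ allVecs xs m
allVecs-complete [] _ = here refl
allVecs-complete {xs = xs} (x ∷ v) v⊆xs =
  ∈-concat⁺′ (∈-map⁺ (x ∷_) (allVecs-complete v (v⊆xs ∘ suc)))
             (∈-map⁺ (λ y → List.map (y ∷_) (allVecs xs _)) (v⊆xs zero))

bool∈ : ∀ b → b ∈ true ∷ false ∷ []
bool∈ true = here refl
bool∈ false = there (here refl)

allMats-complete : (M : Mat m) → ∃ λ M′ → M′ ∈ allMats m × (∀ i j → M′ i j ≡ M i j)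
allMats-complete {m} M = _ , ∈-map⁺ _ rows∈ , λ i j →
  ≡.trans (≡.cong (λ row → lookup row j) (lookup∘tabulate _ i)) (lookup∘tabulate _ j)
  where
  rows : Vec (Vec Bool m) m
  rows = tabulate (tabulate ∘ M)

  rows∈ : rows ∈ allVecs (allVecs (true ∷ false ∷ []) m) m
  rows∈ = allVecs-complete rows λ i →
    ≡.subst (_∈ _) (≡.sym (lookup∘tabulate _ i)) (allVecs-complete _ (bool∈ ∘ _))

collectAdj-complete : ∀ (Ms : List (Mat m)) {M} → M ∈ Ms → (M-adj : IsAdj M) →
  ∃ λ M-adj′ → (M , M-adj′) ∈ collectAdj Ms
collectAdj-complete (M ∷ Ms) (here refl) M-adj with isAdj? M
... | yes M-adj′ = M-adj′ , here refl
... | no ¬M-adj = contradiction M-adj ¬M-adj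
collectAdj-complete (M′ ∷ Ms) (there M∈) M-adj with isAdj? M′
... | yes _ = map₂ there (collectAdj-complete Ms M∈ M-adj)
... | no _ = collectAdj-complete Ms M∈ M-adj

-- Without function extensionality the enumerated copy of A agrees with A only entrywise.
allAdj-complete : (A : Adj m) → ∃ λ A′ → A′ ∈ allAdj m × A′ ≋ A
allAdj-complete {m} (M , M-symmetric , M-irreflexive) with allMats-complete M
... | M′ , M′∈ , M′≗M with collectAdj-complete (allMats m) M′∈ (M′-symmetric , M′-irreflexive)
  where
  M′-symmetric : ∀ i j → M′ i j ≡ M′ j i
  M′-symmetric i j = ≡.trans (M′≗M i j) (≡.trans (M-symmetric i j) (≡.sym (M′≗M j i)))

  M′-irreflexive : ∀ i → M′ i i ≡ false
  M′-irreflexive i = ≡.trans (M′≗M i i) (M-irreflexive i)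
...   | M′-adj , A′∈ = (M′ , M′-adj) , A′∈ , M′≗M

ramseyProp-allAdj : (∀ A → A ∈ allAdj n → HasHomogeneousSet A k) → RamseyProp k n
ramseyProp-allAdj hom A =
  let A′ , A′∈ , A′≋A = allAdj-complete A
  in Sum.map (hasHomogeneous-cong {A = A′} {A′ = A} A′≋A) (hasHomogeneous-cong {A = A′} {A′ = A} A′≋A)
             (hom A′ A′∈)

ramseyProp-mono : m ≤ n → RamseyProp k m → RamseyProp k n
ramseyProp-mono m≤n ramsey A =
  let S , S∈ = subsets-inhabited m≤n
  in Sum.map (sub-hasHomogeneous A S (∈-subsets⇒distinct S∈)) (sub-hasHomogeneous A S (∈-subsets⇒distinct S∈))
             (ramsey (sub A S))

ramseyProp⇔≤ : ∀ {r} → IsRamseyNumber k r → 1 ≤ n → RamseyProp k n ⇔ r ≤ n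
ramseyProp⇔≤ {n = n} (_ , ramsey , minimal) 1≤n =
  mk⇔ (λ ramsey-n → ≮⇒≥ λ n<r → minimal n 1≤n n<r ramsey-n) (λ r≤n → ramseyProp-mono r≤n ramsey)

module _ {c ℓ : Level} (R : CommutativeRing c ℓ) where
  open CommutativeRing R hiding (refl)

  prodR-zero : ∀ {xs} → Any (_≈ 0#) xs → prodR R xs ≈ 0#
  prodR-zero (here x≈0) = trans (*-congʳ x≈0) (zeroˡ _)
  prodR-zero {x ∷ _} (there any) = trans (*-congˡ (prodR-zero any)) (zeroʳ x)

  sumR-zero : ∀ {xs} → All (_≈ 0#) xs → sumR R xs ≈ 0#
  sumR-zero [] = CommutativeRing.refl R
  sumR-zero (x≈0 ∷ xs≈0) = trans (+-cong x≈0 (sumR-zero xs≈0)) (+-identityˡ 0#)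

  -- P is not assumed to respect ≈, so sums and products land in P only up to ≈.
  module _ {p} (P : Carrier → Set p) where

    P≈ : Carrier → Set (c ⊔ ℓ ⊔ p)
    P≈ x = ∃ λ s → P s × x ≈ s

    P≈-nonzero : (∀ x → P x → ¬ x ≈ 0#) → ∀ {x} → P≈ x → ¬ x ≈ 0#
    P≈-nonzero 0∉P (s , s∈P , x≈s) x≈0 = 0∉P s s∈P (trans (sym x≈s) x≈0)

    prodR-P≈ : (∀ x y → P x → P y → P (x * y)) → ∀ {x xs} → x ∈ xs → All P xs → P≈ (prodR R xs)
    prodR-P≈ *-closed _ (x∈P ∷ []) = _ , x∈P , *-identityʳ _
    prodR-P≈ *-closed _ (x∈P ∷ xs∈P@(_ ∷ _)) =
      let s , s∈P , prod≈s = prodR-P≈ *-closed (here refl) xs∈P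
      in _ , *-closed _ s x∈P s∈P , *-congˡ prod≈s

    sumR-zero-or-P≈ : (∀ x y → P x → P y → P (x + y)) →
      ∀ {xs} → All (λ x → x ≈ 0# ⊎ P≈ x) xs → All (_≈ 0#) xs ⊎ P≈ (sumR R xs)
    sumR-zero-or-P≈ +-closed [] = inj₁ []
    sumR-zero-or-P≈ +-closed (x-cases ∷ xs-cases) with x-cases | sumR-zero-or-P≈ +-closed xs-cases
    ... | inj₁ x≈0 | inj₁ xs≈0 = inj₁ (x≈0 ∷ xs≈0)
    ... | inj₁ x≈0 | inj₂ (s , s∈P , sum≈s) = inj₂ (s , s∈P , trans (+-cong x≈0 sum≈s) (+-identityˡ s))
    ... | inj₂ (s , s∈P , x≈s) | inj₁ xs≈0 = inj₂ (s , s∈P , trans (+-cong x≈s (sumR-zero xs≈0)) (+-identityʳ s))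
    ... | inj₂ (s , s∈P , x≈s) | inj₂ (t , t∈P , sum≈t) = inj₂ (s + t , +-closed s t s∈P t∈P , +-cong x≈s sum≈t)

module GraphSum {c ℓ : Level} (R : CommutativeRing c ℓ) where
  open CommutativeRing R

  module _ {p} (P : Carrier → Set p) (0∉P : ∀ x → P x → ¬ x ≈ 0#)
    (+-closed : ∀ x y → P x → P y → P (x + y)) (*-closed : ∀ x y → P x → P y → P (x * y))
    (n k : ℕ) (k≤n : k ≤ n) (f : Adj k → Carrier)
    (f-complete : ∀ M → IsComplete M → f M ≈ 0#) (f-empty : ∀ M → IsEmptyGraph M → f M ≈ 0#)
    (f-P : ∀ M → ¬ IsComplete M → ¬ IsEmptyGraph M → P (f M)) where

    term : Adj n → Carrier
    term A = prodR R (map (λ S → f (sub A S)) (subsets k n))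

    f-homogeneous : (B : Adj k) → Homogeneous B → f B ≈ 0#
    f-homogeneous B (inj₁ complete) = f-complete B complete
    f-homogeneous B (inj₂ mono) = f-empty B (Equivalence.from (emptyGraph⇔monochromatic-false B) mono)

    f-inhomogeneous : (B : Adj k) → ¬ Homogeneous B → P (f B)
    f-inhomogeneous B ¬hom = f-P B (¬hom ∘ inj₁) (¬hom ∘ inj₂ ∘ Equivalence.to (emptyGraph⇔monochromatic-false B))

    HomogeneousSub : Adj n → Set
    HomogeneousSub A = Any (λ S → Homogeneous (sub A S)) (subsets k n)

    term-zero : ∀ A → HomogeneousSub A → term A ≈ 0#
    term-zero A hom = prodR-zero R (Anyₚ.map⁺ (Any.map (f-homogeneous _) hom))

    term-P≈ : ∀ A → ¬ HomogeneousSub A → P≈ R P (term A)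
    term-P≈ A ¬hom =
      let S , S∈ = subsets-inhabited k≤n
      in prodR-P≈ R P *-closed (∈-map⁺ _ S∈) (Allₚ.map⁺ (All.map (f-inhomogeneous _) (Allₚ.¬Any⇒All¬ _ ¬hom)))

    term-zero-or-P≈ : ∀ A → term A ≈ 0# ⊎ P≈ R P (term A)
    term-zero-or-P≈ A with Any.any? (homogeneous? ∘ sub A) (subsets k n)
    ... | yes hom = inj₁ (term-zero A hom)
    ... | no ¬hom = inj₂ (term-P≈ A ¬hom)

    term-zero⇒homogeneousSub : ∀ A → term A ≈ 0# → HomogeneousSub A
    term-zero⇒homogeneousSub A term≈0 with Any.any? (homogeneous? ∘ sub A) (subsets k n)
    ... | yes hom = hom
    ... | no ¬hom = contradiction term≈0 (P≈-nonzero R P 0∉P (term-P≈ A ¬hom))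

    sum-zero⇔ramseyProp : sumR R (map term (allAdj n)) ≈ 0# ⇔ RamseyProp k n
    sum-zero⇔ramseyProp = mk⇔ to from
      where
      from : RamseyProp k n → sumR R (map term (allAdj n)) ≈ 0#
      from ramsey = sumR-zero R (Allₚ.map⁺ (All.universal
        (λ A → term-zero A (Equivalence.to (hasHomogeneousSet⇔homogeneous-sub A) (ramsey A))) (allAdj n)))

      to : sumR R (map term (allAdj n)) ≈ 0# → RamseyProp k n
      to sum≈0 with sumR-zero-or-P≈ R P +-closed (Allₚ.map⁺ (All.universal term-zero-or-P≈ (allAdj n)))
      ... | inj₂ sum∈P≈ = contradiction sum≈0 (P≈-nonzero R P 0∉P sum∈P≈)
      ... | inj₁ terms≈0 = ramseyProp-allAdj λ A A∈ →
        Equivalence.from (hasHomogeneousSet⇔homogeneous-sub A)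
          (term-zero⇒homogeneousSub A (All.lookup (Allₚ.map⁻ terms≈0) A∈))

lemma3p1 : ∀ {c ℓ p : Level} (R : CommutativeRing c ℓ) →
    let open CommutativeRing R in
    (P : Carrier → Set p) →
    (∀ x → P x → ¬ (x ≈ 0#)) →
    (∀ x y → P x → P y → P (x + y)) →
    (∀ x y → P x → P y → P (x * y)) →
    (n k : ℕ) → 2 ≤ k → k ≤ n →
    (f : Adj k → Carrier) →
    (∀ M → IsComplete M → f M ≈ 0#) →
    (∀ M → IsEmptyGraph M → f M ≈ 0#) →
    (∀ M → ¬ IsComplete M → ¬ IsEmptyGraph M → P (f M)) →
    (r : ℕ) → IsRamseyNumber k r →
    ((sumR R (map (λ A → prodR R (map (λ S → f (sub A S)) (subsets k n))) (allAdj n)) ≈ 0#) ⇔ (r ≤ n))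
lemma3p1 R P 0∉P +-closed *-closed n k 2≤k k≤n f f-complete f-empty f-P r isRamsey =
  ramseyProp⇔≤ isRamsey 1≤n ⇔-∘ sum-zero⇔ramseyProp P 0∉P +-closed *-closed n k k≤n f f-complete f-empty f-P
  where
  open GraphSum R

  1≤n : 1 ≤ n
  1≤n = ≤-trans (s≤s z≤n) (≤-trans 2≤k k≤n)
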